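{- Let $n\geqslant 5$ and $3<m<n$. The set $\{r_n,r_m,r_3\}$ generates $\mathrm{Sym}_n$ if and only if one of the following holds: (i) $n$ is even and $m=n-2$; (ii) $n\equiv 1$ or $5\pmod 6$ and $m\in\{n-3,n-1\}$; (iii) $n\equiv 3\pmod 6$ and $m=n-1$.
   Context: $\mathrm{Sym}_n$ is the symmetric group on $\{1,\dots,n\}$. For $1< i\leqslant n$, the prefix reversal $r_i\in\mathrm{Sym}_n$ is the permutation with $r_i(j)=i+1-j$ for $1\leqslant j\leqslant i$ and $r_i(j)=j$ for $i<j\leqslant n$. -}

module Defs where

open import Data.Nat using (ℕ; _<?_; _≤?_)
open import Data.Fin using (Fin; toℕ; fromℕ<; inject≤; opposite)
open import Data.Product using (Σ; _×_)
open import Data.List using (List)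
open import Data.List.Membership.Propositional using (_∈_)
open import Relation.Nullary using (yes; no)
open import Relation.Binary.PropositionalEquality using (_≡_)

-- Maps {1..n} → {1..n}, encoded 0-indexed: the point j+1 is the element j : Fin n.
Map : ℕ → Set
Map n = Fin n → Fin n

idMap : ∀ {n} → Map n
idMap j = j

_∘m_ : ∀ {n} → Map n → Map n → Map n
(f ∘m g) j = f (g j)

_≗m_ : ∀ {n} → Map n → Map n → Set
f ≗m g = ∀ j → f j ≡ g j

IsPerm : ∀ {n} → Map n → Set
IsPerm {n} f = Σ (Map n) λ g → ((g ∘m f) ≗m idMap) × ((f ∘m g) ≗m idMap)

-- Prefix reversal r_i on {1..n}: r_i(j) = i+1-j for j ≤ i, r_i(j) = j otherwise.
-- 0-indexed: j ↦ i-1-j for j < i, j ↦ j otherwise.  (Only used with 1 < i ≤ n;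
-- if i > n it is defined as the identity, which never occurs in the statement.)
prefixRev : (n i : ℕ) → Map n
prefixRev n i j with toℕ j <? i | i ≤? n
... | yes j<i | yes i≤n = inject≤ (opposite (fromℕ< j<i)) i≤n
... | _       | _       = j

data InGen {n : ℕ} (S : List (Map n)) : Map n → Set where
  gen  : ∀ {f} → f ∈ S → InGen S f
  one  : InGen S idMap
  comp : ∀ {f g} → InGen S f → InGen S g → InGen S (f ∘m g)
  inv  : ∀ {f g} → InGen S f → (g ∘m f) ≗m idMap → (f ∘m g) ≗m idMap → InGen S g
  ext  : ∀ {f g} → InGen S f → f ≗m g → InGen S g

Generates : (n : ℕ) → List (Map n) → Set
Generates n S = ∀ (f : Map n) → IsPerm f → InGen S f

{-# OPTIONS --safe #-}
-- Call positions a and b linked when the transposition (a b) lies in the subgroup G generated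
-- by r_n, r_m and r_3. Linkedness is an equivalence relation, it is preserved by every rᵢ
-- (conjugate the transposition by rᵢ), and G = Sym_n exactly when all positions are linked.
-- r_3 links 0 with 2, and conjugating by r_m and then by r_n translates the positions below m
-- by d = n − m; so once j is linked with j + 2 for every j < d this holds for every j, and then
-- a single link between an even and an odd position links everything. For d = 1, 2, 3 (with m
-- even, and 3 ∤ n when d = 3) a few explicit conjugations supply these links.
-- In every other case each generator preserves or exchanges the two classes of a 2-colouring
-- of the positions, while a transposition of two differently coloured positions does neither:
-- colour by parity if m is odd, by the residues c and n − 1 − c modulo d for a suitable c if
-- d ≥ 5 or d = 3 divides n, and by the residues 0, 2, m − 3, m − 1 modulo 8 if d = 4 and n is
-- even.
module Submission where

open import Defs
open import Data.Bool.Base using (if_then_else_; _∨_)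
open import Data.Empty using (⊥-elim)
open import Data.Fin using (Fin; toℕ; fromℕ<; inject≤; opposite)
open import Data.Fin.Patterns using (0F; 1F; 2F)
open import Data.Fin.Permutation.Components using (transpose; transpose-inverse)
open import Data.Fin.Properties
  using (toℕ-injective; toℕ-fromℕ<; fromℕ<-injective; toℕ-inject≤; opposite-prop; toℕ<n)
  renaming (_≟_ to _≟ᶠ_)
open import Data.List using (List; _∷_; [])
open import Data.List.Membership.Propositional using (_∈_)
open import Data.List.Relation.Unary.Any using (here; there)
open import Data.Nat
  using (ℕ; zero; suc; _+_; _*_; _∸_; _≤_; _<_; z≤n; s≤s; _<?_; _≤?_; _%_; _/_; _≡ᵇ_; NonZero; parity)
open import Data.Nat.Divisibility using (divides)
open import Data.Nat.DivMod
  using ( m≡m%n+[m/n]*n; m<n⇒m%n≡m; m%n<n; m%n%n≡m%n; %-distribˡ-+; [m+n]%n≡m%n; [m+kn]%n≡m%n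
        ; m*n%n≡0; m∣n⇒o%n%m≡o%m; _divMod_; result)
open import Data.Nat.Induction using (<-rec)
open import Data.Nat.Properties
open import Data.Nat.Tactic.RingSolver using (solve)
open import Data.Parity.Base as ℙ using (Parity; 0ℙ; 1ℙ; _⁻¹)
import Data.Parity.Properties as ℙ
open import Data.Product using (∃-syntax; _×_; _,_; proj₁; proj₂)
open import Data.Sum using (_⊎_; inj₁; inj₂)
open import Function.Base using (_∘_)
open import Function.Bundles using (_⇔_; mk⇔)
open import Relation.Binary.PropositionalEquality
open import Relation.Nullary using (Dec; yes; no; ¬_; does)
open import Relation.Nullary.Decidable
  using (dec-true; dec-false; does-⇔; _⊎-dec_; _×-dec_; _→-dec_; ¬?; True; toWitness; from-yes)

+-suc-comm : ∀ u v → u + suc v ≡ v + suc u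
+-suc-comm u v = trans (+-suc u v) (trans (cong suc (+-comm u v)) (sym (+-suc v u)))

periodic-induction : ∀ {ℓ} (P : ℕ → Set ℓ) {d} → 0 < d → (∀ {r} → r < d → P r) →
                     (∀ {j} → P j → P (d + j)) → ∀ j → P j
periodic-induction P {d} 0<d base step = <-rec P go
  where
  go : ∀ j → (∀ {i} → i < j → P i) → P j
  go j rec with j <? d
  ... | yes j<d = base j<d
  ... | no j≮d = subst P (m+[n∸m]≡n d≤j) (step (rec (∸-monoʳ-< 0<d d≤j)))
    where
    d≤j : d ≤ j
    d≤j = ≮⇒≥ j≮d

%-+-cong : ∀ {a a′ b b′} D .{{_ : NonZero D}} →
           a % D ≡ a′ % D → b % D ≡ b′ % D → (a + b) % D ≡ (a′ + b′) % D
%-+-cong {a} {a′} {b} {b′} D a≡a′ b≡b′ = begin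
  (a + b) % D           ≡⟨ %-distribˡ-+ a b D ⟩
  (a % D + b % D) % D   ≡⟨ cong₂ (λ x y → (x + y) % D) a≡a′ b≡b′ ⟩
  (a′ % D + b′ % D) % D ≡⟨ %-distribˡ-+ a′ b′ D ⟨
  (a′ + b′) % D         ∎
  where open ≡-Reasoning

%-+-cancelʳ : ∀ {a b} x D .{{_ : NonZero D}} → (a + x) % D ≡ (b + x) % D → a % D ≡ b % D
%-+-cancelʳ {a} {b} x D@(suc D-1) a+x≡b+x = begin
  a % D                 ≡⟨ [m+kn]%n≡m%n a x D ⟨
  (a + x * D) % D       ≡⟨ cong (_% D) (regroup a) ⟩
  (a + x + x * D-1) % D ≡⟨ %-+-cong {a + x} {b + x} {x * D-1} D a+x≡b+x refl ⟩
  (b + x + x * D-1) % D ≡⟨ cong (_% D) (regroup b) ⟨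
  (b + x * D) % D       ≡⟨ [m+kn]%n≡m%n b x D ⟩
  b % D                 ∎
  where
  open ≡-Reasoning
  regroup : ∀ c → c + x * D ≡ c + x + x * D-1
  regroup c = solve (c ∷ x ∷ D-1 ∷ [])

%-shift-≢ : ∀ {k} b D .{{_ : NonZero D}} → 0 < k → k < D → (k + b) % D ≢ b % D
%-shift-≢ {k} b D 0<k k<D k+b≡b = <⇒≢ 0<k (sym (begin
  k     ≡⟨ m<n⇒m%n≡m k<D ⟨
  k % D ≡⟨ %-+-cancelʳ b D k+b≡b ⟩
  0 % D ≡⟨ m<n⇒m%n≡m (≤-<-trans z≤n k<D) ⟩
  0     ∎))
  where open ≡-Reasoning

0ℙ≢1ℙ : 0ℙ ≢ 1ℙ
0ℙ≢1ℙ ()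

parity-suc : ∀ n → parity (suc n) ≡ parity n ⁻¹
parity-suc n = sym (ℙ.⁻¹-selfInverse (ℙ.suc-homo-⁻¹ n))

odd-suc⇒even : ∀ x → parity (suc x) ≡ 1ℙ → parity x ≡ 0ℙ
odd-suc⇒even x odd = sym (ℙ.⁻¹-selfInverse (trans (sym (parity-suc x)) odd))

even⇒odd-suc : ∀ x → parity x ≡ 0ℙ → parity (suc x) ≡ 1ℙ
even⇒odd-suc x even = trans (parity-suc x) (cong _⁻¹ even)

parity-%-even : ∀ n d .{{_ : NonZero d}} → parity d ≡ 0ℙ → parity (n % d) ≡ parity n
parity-%-even n d d-even = sym (begin
  parity n                                     ≡⟨ cong parity (m≡m%n+[m/n]*n n d) ⟩
  parity (r + q * d)                           ≡⟨ ℙ.+-homo-+ r (q * d) ⟩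
  parity r ℙ.+ parity (q * d)                  ≡⟨ cong (parity r ℙ.+_) (ℙ.*-homo-* q d) ⟩
  parity r ℙ.+ (parity q ℙ.* parity d)         ≡⟨ cong (λ p → parity r ℙ.+ (parity q ℙ.* p)) d-even ⟩
  parity r ℙ.+ (parity q ℙ.* 0ℙ)               ≡⟨ cong (parity r ℙ.+_) (ℙ.*-zeroʳ (parity q)) ⟩
  parity r ℙ.+ 0ℙ                              ≡⟨ ℙ.+-identityʳ (parity r) ⟩
  parity r                                     ∎)
  where
  open ≡-Reasoning
  r q : ℕ
  r = n % d
  q = n / d

data Reflects (i : ℕ) : ℕ → ℕ → Set where
  inside  : ∀ {u v} → v + suc u ≡ i → Reflects i u v
  outside : ∀ {u} → i ≤ u → Reflects i u u

Reflects-sym : ∀ {i u v} → Reflects i u v → Reflects i v u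
Reflects-sym {u = u} {v} (inside eq) = inside (trans (+-suc-comm u v) eq)
Reflects-sym (outside le) = outside le

v+1+u≡i⇒u<i : ∀ {i u v} → v + suc u ≡ i → u < i
v+1+u≡i⇒u<i {u = u} {v} e = subst (suc u ≤_) e (m≤n+m (suc u) v)

Reflects-functional : ∀ {i u v w} → Reflects i u v → Reflects i u w → v ≡ w
Reflects-functional {u = u} (inside e) (inside f) = +-cancelʳ-≡ (suc u) _ _ (trans e (sym f))
Reflects-functional (inside e) (outside i≤u) = ⊥-elim (<⇒≱ (v+1+u≡i⇒u<i e) i≤u)
Reflects-functional (outside i≤u) (inside f) = ⊥-elim (<⇒≱ (v+1+u≡i⇒u<i f) i≤u)
Reflects-functional (outside _) (outside _) = refl

prefixRev-reflects : ∀ {n i} → i ≤ n → ∀ j → Reflects i (toℕ j) (toℕ (prefixRev n i j))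
prefixRev-reflects {n} {i} i≤n j with toℕ j <? i | i ≤? n
... | yes j<i | yes i≤n′ = inside (begin
  toℕ (inject≤ (opposite (fromℕ< j<i)) i≤n′) + suc (toℕ j) ≡⟨ cong (_+ suc (toℕ j)) (toℕ-inject≤ _ i≤n′) ⟩
  toℕ (opposite (fromℕ< j<i)) + suc (toℕ j)               ≡⟨ cong (_+ suc (toℕ j)) (opposite-prop _) ⟩
  i ∸ suc (toℕ (fromℕ< j<i)) + suc (toℕ j)                ≡⟨ cong (λ x → i ∸ suc x + suc (toℕ j))
                                                                       (toℕ-fromℕ< j<i) ⟩
  i ∸ suc (toℕ j) + suc (toℕ j)                          ≡⟨ m∸n+n≡m j<i ⟩
  i                                                      ∎)
  where open ≡-Reasoning
... | yes _   | no i≰n = ⊥-elim (i≰n i≤n)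
... | no j≮i  | _      = outside (≮⇒≥ j≮i)

prefixRev-involutive : ∀ {n i} → i ≤ n → ∀ j → prefixRev n i (prefixRev n i j) ≡ j
prefixRev-involutive {n} {i} i≤n j = toℕ-injective (Reflects-functional
  (prefixRev-reflects i≤n (prefixRev n i j)) (Reflects-sym (prefixRev-reflects i≤n j)))

module _ {n : ℕ} where

  transpose-matchˡ : (i j : Fin n) → transpose i j i ≡ j
  transpose-matchˡ i j rewrite dec-true (i ≟ᶠ i) refl = refl

  transpose-matchʳ : (i j : Fin n) → transpose i j j ≡ i
  transpose-matchʳ i j with j ≟ᶠ i
  ... | yes j≡i = j≡i
  ... | no _ rewrite dec-true (j ≟ᶠ j) refl = refl

  transpose-other : ∀ {i j k : Fin n} → k ≢ i → k ≢ j → transpose i j k ≡ k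
  transpose-other {i} {j} {k} k≢i k≢j rewrite dec-false (k ≟ᶠ i) k≢i | dec-false (k ≟ᶠ j) k≢j = refl

  ≗-transpose : ∀ {i j} (f : Map n) → f i ≡ j → f j ≡ i →
                (∀ {k} → k ≢ i → k ≢ j → f k ≡ k) → f ≗m transpose i j
  ≗-transpose {i} {j} f fi fj fk k with k ≟ᶠ i | k ≟ᶠ j
  ... | yes refl | _        = fi
  ... | no _     | yes refl rewrite dec-true (k ≟ᶠ k) refl = fj
  ... | no k≢i   | no k≢j rewrite dec-false (k ≟ᶠ j) k≢j = fk k≢i k≢j

  transpose-comm : (i j : Fin n) → transpose j i ≗m transpose i j
  transpose-comm i j = ≗-transpose (transpose j i) (transpose-matchʳ j i) (transpose-matchˡ j i)
    (λ k≢i k≢j → transpose-other k≢j k≢i)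

  transpose-involutive : (i j k : Fin n) → transpose i j (transpose i j k) ≡ k
  transpose-involutive i j k = trans (cong (transpose i j) (sym (transpose-comm i j k))) (transpose-inverse i j)

  transpose-isPerm : (i j : Fin n) → IsPerm (transpose i j)
  transpose-isPerm i j = transpose j i , (λ _ → transpose-inverse j i) , (λ _ → transpose-inverse i j)

  transpose-same : (i : Fin n) → idMap ≗m transpose i i
  transpose-same i = ≗-transpose idMap refl refl (λ _ _ → refl)

  transpose-conj : (s : Map n) → (∀ j → s (s j) ≡ j) → (i j : Fin n) →
                   (s ∘m (transpose i j ∘m s)) ≗m transpose (s i) (s j)
  transpose-conj s s-invol i j = ≗-transpose (s ∘m (transpose i j ∘m s))
    (trans (cong (s ∘m transpose i j) (s-invol i)) (cong s (transpose-matchˡ i j)))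
    (trans (cong (s ∘m transpose i j) (s-invol j)) (cong s (transpose-matchʳ i j)))
    (λ {k} k≢si k≢sj → trans (cong s (transpose-other (k≢si ∘ s-moves) (k≢sj ∘ s-moves))) (s-invol k))
    where
    s-moves : ∀ {k l} → s k ≡ l → k ≡ s l
    s-moves {k} refl = sym (s-invol k)

-- Linked positions

module Generated {n : ℕ} (S : List (Map n)) where

  module _ (transpositions : ∀ i j → InGen S (transpose i j)) where

    generated-if-fixes-from : ∀ k (f : Map n) → (∀ {i j} → f i ≡ f j → i ≡ j) →
                              (∀ j → k ≤ toℕ j → f j ≡ j) → InGen S f
    generated-if-fixes-from zero f _ fixes = ext one (λ j → sym (fixes j z≤n))
    generated-if-fixes-from (suc k) f f-inj fixes with k <? n
    ... | no k≮n =
      generated-if-fixes-from k f f-inj (λ j k≤j → ⊥-elim (k≮n (≤-<-trans k≤j (toℕ<n j))))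
    ... | yes k<n = ext (comp (transpositions a (f a)) (generated-if-fixes-from k g g-inj g-fixes))
                        (λ j → transpose-inverse a (f a))
      where
      a : Fin n
      a = fromℕ< k<n
      g : Map n
      g j = transpose (f a) a (f j)
      g-inj : ∀ {i j} → g i ≡ g j → i ≡ j
      g-inj {i} {j} e = f-inj (trans (sym (transpose-involutive (f a) a (f i)))
                                     (trans (cong (transpose (f a) a) e) (transpose-involutive (f a) a (f j))))
      g-fixes : ∀ j → k ≤ toℕ j → g j ≡ j
      g-fixes j k≤j with toℕ j ≟ k
      ... | yes j≡k rewrite toℕ-injective (trans j≡k (sym (toℕ-fromℕ< k<n))) = transpose-matchˡ (f a) a
      ... | no j≢k =
        trans (cong (transpose (f a) a) fj≡j) (transpose-other (j≢a ∘ f-inj ∘ trans fj≡j) j≢a)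
        where
        fj≡j : f j ≡ j
        fj≡j = fixes j (≤∧≢⇒< k≤j (j≢k ∘ sym))
        j≢a : j ≢ a
        j≢a refl = j≢k (toℕ-fromℕ< k<n)

    generated-if-transpositions : Generates n S
    generated-if-transpositions f (f⁻¹ , f⁻¹∘f≗id , _) =
      generated-if-fixes-from n f f-inj (λ j n≤j → ⊥-elim (<⇒≱ (toℕ<n j) n≤j))
      where
      f-inj : ∀ {i j} → f i ≡ f j → i ≡ j
      f-inj {i} {j} e = trans (sym (f⁻¹∘f≗id i)) (trans (cong f⁻¹ e) (f⁻¹∘f≗id j))

  -- Positions ≥ n do not exist, so links involving them hold vacuously.
  Linked : ℕ → ℕ → Set
  Linked a b = ∀ {x y : Fin n} → toℕ x ≡ a → toℕ y ≡ b → InGen S (transpose x y)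

  Linked-refl : ∀ {a} → Linked a a
  Linked-refl {x = x} refl x≡y rewrite toℕ-injective x≡y = ext one (transpose-same x)

  Linked-sym : ∀ {a b} → Linked a b → Linked b a
  Linked-sym a~b y≡b x≡a = ext (a~b x≡a y≡b) (transpose-comm _ _)

  Linked-beyond : ∀ {a b} → n ≤ b → Linked a b
  Linked-beyond n≤b {y = y} _ refl = ⊥-elim (<⇒≱ (toℕ<n y) n≤b)

  Linked-trans : ∀ {a b c} → b < n → Linked a b → Linked b c → Linked a c
  Linked-trans {b = b} b<n a~b b~c {x} {z} x≡a z≡c with z ≟ᶠ x | z ≟ᶠ fromℕ< b<n
  ... | yes refl | _ = Linked-refl {toℕ z} refl refl
  ... | no _ | yes refl = a~b x≡a (toℕ-fromℕ< b<n)
  ... | no z≢x | no z≢y = ext (comp (a~b x≡a y≡b) (comp (b~c y≡b z≡c) (a~b x≡a y≡b)))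
          (λ j → trans (transpose-conj (transpose x y) (transpose-involutive x y) y z j)
                       (cong₂ (λ u v → transpose u v j) (transpose-matchʳ x y) (transpose-other z≢x z≢y)))
    where
    y : Fin n
    y = fromℕ< b<n
    y≡b : toℕ y ≡ b
    y≡b = toℕ-fromℕ< b<n

  Linked-trans-≤ : ∀ {a b c} → b ≤ c → Linked a b → Linked b c → Linked a c
  Linked-trans-≤ {b = b} {c} b≤c a~b b~c with b <? n
  ... | yes b<n = Linked-trans b<n a~b b~c
  ... | no b≮n = Linked-beyond (≤-trans (≮⇒≥ b≮n) b≤c)

  Linked-reflect : ∀ {i a b a′ b′} → prefixRev n i ∈ S → i ≤ n →
                   Reflects i a a′ → Reflects i b b′ → Linked a b → Linked a′ b′
  Linked-reflect {i} r∈S i≤n a↦a′ b↦b′ a~b {x} {y} x≡a′ y≡b′ =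
    ext (comp (gen r∈S) (comp (a~b (image x≡a′ a↦a′) (image y≡b′ b↦b′)) (gen r∈S)))
        (λ j → trans (transpose-conj r (prefixRev-involutive i≤n) (r x) (r y) j)
                     (cong₂ (λ u v → transpose u v j) (prefixRev-involutive i≤n x)
                                                        (prefixRev-involutive i≤n y)))
    where
    r : Map n
    r = prefixRev n i
    image : ∀ {z : Fin n} {c c′} → toℕ z ≡ c′ → Reflects i c c′ → toℕ (r z) ≡ c
    image {z} refl c↦z = Reflects-functional (prefixRev-reflects i≤n z) (Reflects-sym c↦z)

  Linked-total⇒Generates : (∀ a b → Linked a b) → Generates n S
  Linked-total⇒Generates linked = generated-if-transpositions (λ x y → linked (toℕ x) (toℕ y) refl refl)

reversals : (n m : ℕ) → List (Map n)
reversals n m = prefixRev n n ∷ prefixRev n m ∷ prefixRev n 3 ∷ []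

module ReversalLinks (d m : ℕ) (3≤n : 3 ≤ d + m) where

  open Generated (reversals (d + m) m) public

  reflect-n : ∀ {a b a′ b′} → Reflects (d + m) a a′ → Reflects (d + m) b b′ →
              Linked a b → Linked a′ b′
  reflect-n = Linked-reflect (here refl) ≤-refl

  reflect-m : ∀ {a b a′ b′} → Reflects m a a′ → Reflects m b b′ → Linked a b → Linked a′ b′
  reflect-m = Linked-reflect (there (here refl)) (m≤n+m m d)

  Linked-0-2 : Linked 0 2
  Linked-0-2 {x} {y} x≡0 y≡2 = ext (gen (there (there (here refl))))
    (≗-transpose r₃ (moves (inside (cong₂ (λ a b → b + suc a) x≡0 y≡2)))
                    (moves (inside (cong₂ (λ a b → b + suc a) y≡2 x≡0)))
                    (λ k≢x k≢y → moves (fixed k≢x k≢y)))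
    where
    r₃ : Map (d + m)
    r₃ = prefixRev (d + m) 3
    moves : ∀ {z w} → Reflects 3 (toℕ z) (toℕ w) → r₃ z ≡ w
    moves {z} z↦w = toℕ-injective (Reflects-functional (prefixRev-reflects 3≤n z) z↦w)
    fixed : ∀ {k} → k ≢ x → k ≢ y → Reflects 3 (toℕ k) (toℕ k)
    fixed {k} k≢x k≢y with toℕ k in e
    ... | 0 = ⊥-elim (k≢x (toℕ-injective (trans e (sym x≡0))))
    ... | 1 = inside refl
    ... | 2 = ⊥-elim (k≢y (toℕ-injective (trans e (sym y≡2))))
    ... | suc (suc (suc _)) = outside (s≤s (s≤s (s≤s z≤n)))

  Linked+2 : ℕ → Set
  Linked+2 j = Linked j (2 + j)

  Linked+2-shift : ∀ {j} → Linked+2 j → Linked+2 (d + j)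
  Linked+2-shift {j} j~j+2 with 3 + j ≤? m
  ... | yes 3+j≤m with m≤n⇒∃[o]m+o≡n 3+j≤m
  ...   | k , refl =
    reflect-n (inside ρn-2+k) (inside ρn-k) (reflect-m (inside ρm-j) (inside ρm-2+j) j~j+2)
    where
    ρm-j : (2 + k) + suc j ≡ (3 + j) + k
    ρm-j = solve (j ∷ k ∷ [])
    ρm-2+j : k + suc (2 + j) ≡ (3 + j) + k
    ρm-2+j = solve (j ∷ k ∷ [])
    ρn-2+k : (d + j) + suc (2 + k) ≡ d + ((3 + j) + k)
    ρn-2+k = solve (d ∷ j ∷ k ∷ [])
    ρn-k : (2 + (d + j)) + suc k ≡ d + ((3 + j) + k)
    ρn-k = solve (d ∷ j ∷ k ∷ [])
  Linked+2-shift {j} _ | no 3+j≰m = Linked-beyond (begin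
    d + m       ≤⟨ +-monoʳ-≤ d (≤-pred (≰⇒> 3+j≰m)) ⟩
    d + (2 + j) ≡⟨ solve (d ∷ j ∷ []) ⟩
    2 + (d + j) ∎)
    where open ≤-Reasoning

  Linked-1-m : ∀ {t} → 2 + t ≡ m → Linked+2 t → Linked 1 m
  Linked-1-m refl = reflect-m (inside refl) (outside ≤-refl)

  Linked+2-everywhere : 0 < d → (∀ {r} → r < d → Linked+2 r) → ∀ j → Linked+2 j
  Linked+2-everywhere 0<d base = periodic-induction Linked+2 0<d base Linked+2-shift

  Linked+2-multiples : ∀ q → Linked+2 (q * d)
  Linked+2-multiples zero = Linked-0-2
  Linked+2-multiples (suc q) = Linked+2-shift (Linked+2-multiples q)

  module _ (linked+2 : ∀ j → Linked+2 j) where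

    Linked-same-parity : ∀ x y → parity x ≡ parity y → Linked x y
    Linked-same-parity zero zero _ = Linked-refl
    Linked-same-parity (suc zero) (suc zero) _ = Linked-refl
    Linked-same-parity (suc (suc x)) y p =
      Linked-sym (Linked-trans-≤ (m≤n+m x 2) (Linked-sym (Linked-same-parity x y p)) (linked+2 x))
    Linked-same-parity x (suc (suc y)) p = Linked-trans-≤ (m≤n+m y 2) (Linked-same-parity x y p) (linked+2 y)
    Linked-same-parity zero (suc zero) ()
    Linked-same-parity (suc zero) zero ()

    generates-if-Linked-0-1 : Linked 0 1 → Generates (d + m) (reversals (d + m) m)
    generates-if-Linked-0-1 0~1 = Linked-total⇒Generates λ a b →
      Linked-trans (≤-trans (s≤s z≤n) 3≤n) (Linked-sym (Linked-to-0 a)) (Linked-to-0 b)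
      where
      Linked-to-0 : ∀ x → Linked 0 x
      Linked-to-0 x with parity x in px
      ... | 0ℙ = Linked-same-parity 0 x (sym px)
      ... | 1ℙ = Linked-trans (≤-trans (s≤s (s≤s z≤n)) 3≤n) 0~1 (Linked-same-parity 1 x (sym px))

  generates-if-m-even : ∀ {t} → 0 < d → (∀ {r} → r < d → Linked+2 r) → 2 + t ≡ m →
                        parity t ≡ 0ℙ → Generates (d + m) (reversals (d + m) m)
  generates-if-m-even 0<d base refl even = generates-if-Linked-0-1 linked+2
    (Linked-trans (m<n+m m 0<d) (Linked-same-parity linked+2 0 m (sym even))
                                (Linked-sym (Linked-1-m refl (linked+2 _))))
    where
    linked+2 : ∀ j → Linked+2 j
    linked+2 = Linked+2-everywhere 0<d base

generates-gap-1 : ∀ t → parity t ≡ 0ℙ → Generates (3 + t) (reversals (3 + t) (2 + t))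
generates-gap-1 t even = generates-if-m-even (s≤s z≤n) base refl even
  where
  open ReversalLinks 1 (2 + t) (m≤m+n 3 t)
  base : ∀ {r} → r < 1 → Linked+2 r
  base {zero} _ = Linked-0-2
  base {suc _} (s≤s ())

generates-gap-2 : ∀ t → parity t ≡ 0ℙ → Generates (4 + t) (reversals (4 + t) (2 + t))
generates-gap-2 t even = generates-if-m-even (s≤s z≤n) base refl even
  where
  open ReversalLinks 2 (2 + t) (m≤n⇒m≤1+n (m≤m+n 3 t))
  Linked+2-even : ∀ j → parity j ≡ 0ℙ → Linked+2 j
  Linked+2-even zero _ = Linked-0-2
  Linked+2-even (suc zero) ()
  Linked+2-even (suc (suc j)) p = Linked+2-shift (Linked+2-even j p)
  base : ∀ {r} → r < 2 → Linked+2 r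
  base {zero} _ = Linked-0-2
  base {suc zero} _ = Linked-sym (reflect-n (inside refl) (inside refl) (Linked+2-even t even))
  base {suc (suc _)} (s≤s (s≤s ()))

generates-gap-3 : ∀ t → parity t ≡ 0ℙ → (5 + t) % 3 ≢ 0 → Generates (5 + t) (reversals (5 + t) (2 + t))
generates-gap-3 t even 3∤n = generates-if-Linked-0-1 linked+2
  (Linked-trans (m<n+m (3 + t) {2} (s≤s z≤n)) Linked-0-m+1
                (Linked-same-parity linked+2 (3 + t) 1 (even⇒odd-suc t even)))
  where
  open ReversalLinks 3 (2 + t) (m≤m+n 3 (2 + t))
  Linked-2-0 : Linked 2 0
  Linked-2-0 = Linked-sym Linked-0-2
  via-m-1 : Linked+2 (1 + t) → Linked 0 (3 + t)
  via-m-1 = reflect-m (inside refl) (outside (n≤1+n _))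
  via-m-2 : Linked+2 t → Linked 0 (3 + t)
  via-m-2 t~m = Linked-sym (Linked-trans (s≤s (s≤s (s≤s z≤n)))
    (reflect-n (inside (+-comm (3 + t) 2)) (inside refl) (Linked-1-m refl t~m)) Linked-2-0)
  Linked+2-1 : Linked 0 (3 + t) → Linked+2 1
  Linked+2-1 0~m+1 = Linked-sym (reflect-n (inside refl) (inside refl)
    (reflect-m (inside (+-comm (1 + t) 1)) (outside (n≤1+n _)) 0~m+1))
  Linked+2-2 : Linked 0 (3 + t) → Linked+2 2
  Linked+2-2 0~m+1 = Linked-trans (s≤s z≤n) Linked-2-0 (reflect-n (inside refl) (inside refl)
    (reflect-m (outside (m≤n+m (2 + t) 2)) (inside (+-comm t 2))
      (reflect-n (inside (+-comm (4 + t) 1)) (inside refl) 0~m+1)))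
  -- 3 ∤ n = m + 3 forces m − 2 ≡ 0 or m − 1 ≡ 0 (mod 3)
  Linked-0-m+1 : Linked 0 (3 + t)
  Linked-0-m+1 with t divMod 3
  ... | result q 0F refl = via-m-2 (Linked+2-multiples q)
  ... | result q 1F refl = ⊥-elim (3∤n (m*n%n≡0 (2 + q) 3))
  ... | result q 2F refl = via-m-1 (Linked+2-multiples (suc q))
  base : ∀ {r} → r < 3 → Linked+2 r
  base {0} _ = Linked-0-2
  base {1} _ = Linked+2-1 Linked-0-m+1
  base {2} _ = Linked+2-2 Linked-0-m+1
  base {suc (suc (suc _))} (s≤s (s≤s (s≤s ())))
  linked+2 : ∀ j → Linked+2 j
  linked+2 = Linked+2-everywhere (s≤s z≤n) base

-- Invariant 2-colourings

module Colouring {n : ℕ} (κ : ℕ → Parity) where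

  Compatible : Map n → Set
  Compatible f = ∃[ p ] ∀ j → κ (toℕ (f j)) ≡ p ℙ.+ κ (toℕ j)

  private
    shift-sym : ∀ p {x y} → x ≡ p ℙ.+ y → y ≡ p ℙ.+ x
    shift-sym 0ℙ e = sym e
    shift-sym 1ℙ e = sym (ℙ.⁻¹-selfInverse (sym e))

  InGen-compatible : ∀ {S} → (∀ {s} → s ∈ S → Compatible s) → ∀ {f} → InGen S f → Compatible f
  InGen-compatible gens (gen s∈S) = gens s∈S
  InGen-compatible gens one = 0ℙ , λ _ → refl
  InGen-compatible gens (comp {f} {g} F G) with InGen-compatible gens F | InGen-compatible gens G
  ... | p , f-shifts | q , g-shifts = p ℙ.+ q , λ j →
    trans (f-shifts (g j)) (trans (cong (p ℙ.+_) (g-shifts j)) (sym (ℙ.+-assoc p q _)))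
  InGen-compatible gens (inv {f} {g} F _ f∘g≗id) with InGen-compatible gens F
  ... | p , f-shifts = p , λ j → shift-sym p (trans (cong (κ ∘ toℕ) (sym (f∘g≗id j))) (f-shifts (g j)))
  InGen-compatible gens (ext F f≗g) with InGen-compatible gens F
  ... | p , f-shifts = p , λ j → trans (cong (κ ∘ toℕ) (sym (f≗g j))) (f-shifts j)

  prefixRev-compatible : ∀ {i} p → i ≤ n → (∀ {u v} → v + suc u ≡ i → κ v ≡ p ℙ.+ κ u) →
                         (i < n → p ≡ 0ℙ) → Compatible (prefixRev n i)
  prefixRev-compatible {i} p i≤n reflection fixed = p , λ j → shifts (toℕ<n j) (prefixRev-reflects i≤n j)
    where
    shifts : ∀ {u v} → u < n → Reflects i u v → κ v ≡ p ℙ.+ κ u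
    shifts _ (inside e) = reflection e
    shifts {u} u<n (outside i≤u) = cong (ℙ._+ κ u) (sym (fixed (≤-<-trans i≤u u<n)))

  transposition-compatible : ∀ {x y z : Fin n} → z ≢ x → z ≢ y → Compatible (transpose x y) →
                             κ (toℕ x) ≡ κ (toℕ y)
  transposition-compatible {x} {y} {z} z≢x z≢y (p , τ-shifts) = begin
    κ (toℕ x)          ≡⟨ cong (ℙ._+ κ (toℕ x)) (sym p≡0) ⟩
    p ℙ.+ κ (toℕ x)    ≡⟨ sym (τ-shifts x) ⟩
    κ (toℕ (transpose x y x)) ≡⟨ cong (κ ∘ toℕ) (transpose-matchˡ x y) ⟩
    κ (toℕ y)          ∎
    where
    open ≡-Reasoning
    p≡0 : p ≡ 0ℙ
    p≡0 = ℙ.+-cancelʳ-≡ (κ (toℕ z)) p 0ℙ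
            (trans (sym (τ-shifts z)) (cong (κ ∘ toℕ) (transpose-other z≢x z≢y)))

  colouring-obstruction : ∀ {S a b c} → (∀ {s} → s ∈ S → Compatible s) →
                          a < n → b < n → c < n → c ≢ a → c ≢ b → κ a ≢ κ b → ¬ Generates n S
  colouring-obstruction gens a<n b<n c<n c≢a c≢b κa≢κb generates =
    κa≢κb (subst₂ (λ a b → κ a ≡ κ b) (toℕ-fromℕ< a<n) (toℕ-fromℕ< b<n)
    (transposition-compatible (c≢a ∘ fromℕ<-injective _ _ c<n a<n) (c≢b ∘ fromℕ<-injective _ _ c<n b<n)
      (InGen-compatible gens (generates _ (transpose-isPerm _ _)))))

  reversals-compatible : ∀ {m} → Compatible (prefixRev n n) → Compatible (prefixRev n m) →
                         Compatible (prefixRev n 3) → ∀ {s} → s ∈ reversals n m → Compatible s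
  reversals-compatible rn _ _ (here refl) = rn
  reversals-compatible _ rm _ (there (here refl)) = rm
  reversals-compatible _ _ r3 (there (there (here refl))) = r3

  prefixRev₃-compatible : 3 ≤ n → κ 0 ≡ κ 2 → Compatible (prefixRev n 3)
  prefixRev₃-compatible 3≤n κ0≡κ2 = prefixRev-compatible 0ℙ 3≤n symmetric (λ _ → refl)
    where
    symmetric : ∀ {u v} → v + suc u ≡ 3 → κ v ≡ κ u
    symmetric {0} e = trans (cong κ (Reflects-functional (inside e) (inside refl))) (sym κ0≡κ2)
    symmetric {1} e = cong κ (Reflects-functional (inside e) (inside refl))
    symmetric {2} e = trans (cong κ (Reflects-functional (inside e) (inside refl))) κ0≡κ2
    symmetric {suc (suc (suc u))} e = ⊥-elim (<⇒≱ (v+1+u≡i⇒u<i e) (m≤m+n 3 u))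

reflection-parity : ∀ {i u v} → v + suc u ≡ i → parity v ≡ parity i ⁻¹ ℙ.+ parity u
reflection-parity {u = u} {v} refl rewrite ℙ.+-homo-+ v (suc u) | parity-suc u = cancel (parity v) (parity u)
  where
  cancel : ∀ p q → p ≡ (p ℙ.+ q ⁻¹) ⁻¹ ℙ.+ q
  cancel 0ℙ 0ℙ = refl
  cancel 0ℙ 1ℙ = refl
  cancel 1ℙ 0ℙ = refl
  cancel 1ℙ 1ℙ = refl

prefixRev-parity-compatible : ∀ {n i} → i ≤ n → (i < n → parity i ≡ 1ℙ) →
                              Colouring.Compatible {n} parity (prefixRev n i)
prefixRev-parity-compatible {i = i} i≤n odd =
  Colouring.prefixRev-compatible parity (parity i ⁻¹) i≤n reflection-parity (cong _⁻¹ ∘ odd)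

odd-m-obstruction : ∀ {n m} → 3 ≤ m → m ≤ n → parity m ≡ 1ℙ → ¬ Generates n (reversals n m)
odd-m-obstruction {n} {m} 3≤m m≤n odd = colouring-obstruction
  (reversals-compatible {m} (prefixRev-parity-compatible ≤-refl (⊥-elim ∘ <-irrefl refl))
                        (prefixRev-parity-compatible m≤n (λ _ → odd))
                        (prefixRev-parity-compatible 3≤n (λ _ → refl)))
  (position (s≤s z≤n)) (position (s≤s (s≤s z≤n))) (position (s≤s (s≤s (s≤s z≤n))))
  (λ ()) (λ ()) (λ ())
  where
  open Colouring {n} parity
  3≤n : 3 ≤ n
  3≤n = ≤-trans 3≤m m≤n
  position : ∀ {k} → k < 3 → k < n
  position k<3 = <-≤-trans k<3 3≤n

module PairColouring (D : ℕ) .{{_ : NonZero D}} (c n : ℕ) where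

  InPair : ℕ → Set
  InPair j = j % D ≡ c % D ⊎ (j + suc c) % D ≡ n % D

  InPair? : ∀ j → Dec (InPair j)
  InPair? j = (j % D ≟ c % D) ⊎-dec ((j + suc c) % D ≟ n % D)

  colour : ℕ → Parity
  colour j = if does (InPair? j) then 1ℙ else 0ℙ

  InPair-reflect : ∀ {i u v} → i % D ≡ n % D → v + suc u ≡ i → InPair v → InPair u
  InPair-reflect {i} {u} {v} i≡n v+1+u≡i (inj₁ v≡c) = inj₂ (begin
    (u + suc c) % D ≡⟨ %-+-cong {u} {u} {suc c} {suc v} D refl (%-+-cong {1} {1} D refl (sym v≡c)) ⟩
    (u + suc v) % D ≡⟨ cong (_% D) (trans (+-suc-comm u v) v+1+u≡i) ⟩
    i % D           ≡⟨ i≡n ⟩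
    n % D           ∎)
    where open ≡-Reasoning
  InPair-reflect {i} {u} {v} i≡n v+1+u≡i (inj₂ v+1+c≡n) = inj₁ (sym (%-+-cancelʳ (suc v) D (begin
    (c + suc v) % D ≡⟨ cong (_% D) (+-suc-comm c v) ⟩
    (v + suc c) % D ≡⟨ v+1+c≡n ⟩
    n % D           ≡⟨ i≡n ⟨
    i % D           ≡⟨ cong (_% D) (trans (sym v+1+u≡i) (+-suc-comm v u)) ⟩
    (u + suc v) % D ∎)))
    where open ≡-Reasoning

  colour-symmetric : ∀ {i u v} → i % D ≡ n % D → v + suc u ≡ i → colour v ≡ colour u
  colour-symmetric {u = u} {v} i≡n e = cong (λ b → if b then 1ℙ else 0ℙ)
    (does-⇔ (mk⇔ (InPair-reflect i≡n e) (InPair-reflect i≡n (trans (+-suc-comm u v) e)))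
            (InPair? v) (InPair? u))

  colour-outside : ∀ {j} → ¬ InPair j → colour j ≡ 0ℙ
  colour-outside {j} ∉ rewrite dec-false (InPair? j) ∉ = refl

  colour-c : colour c ≡ 1ℙ
  colour-c rewrite dec-true (InPair? c) (inj₁ refl) = refl

pair-obstruction : ∀ {D m} c .{{_ : NonZero D}} → 3 ≤ m → c < D + m →
                   ¬ PairColouring.InPair D c (D + m) 0 → ¬ PairColouring.InPair D c (D + m) 2 →
                   ¬ Generates (D + m) (reversals (D + m) m)
pair-obstruction {D} {m} c 3≤m c<n ∉0 ∉2 = colouring-obstruction
  (reversals-compatible {m} (prefixRev-compatible 0ℙ ≤-refl (colour-symmetric refl) (λ _ → refl))
                            (prefixRev-compatible 0ℙ (m≤n+m m D) (colour-symmetric m≡n) (λ _ → refl))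
                            (prefixRev₃-compatible 3≤n (trans (colour-outside ∉0) (sym (colour-outside ∉2)))))
  (<-≤-trans (s≤s z≤n) 3≤n) c<n (<-≤-trans (s≤s (s≤s (s≤s z≤n))) 3≤n)
  (λ ()) (λ { refl → ∉2 (inj₁ refl) })
  (λ κ0≡κc → 0ℙ≢1ℙ (trans (sym (colour-outside ∉0)) (trans κ0≡κc colour-c)))
  where
  open PairColouring D c (D + m)
  open Colouring {D + m} colour
  3≤n : 3 ≤ D + m
  3≤n = ≤-trans 3≤m (m≤n+m m D)
  m≡n : m % D ≡ (D + m) % D
  m≡n = sym (trans (cong (_% D) (+-comm D m)) ([m+n]%n≡m%n m D))

gap-3-obstruction : ∀ {m} → 3 ≤ m → (3 + m) % 3 ≡ 0 → ¬ Generates (3 + m) (reversals (3 + m) m)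
gap-3-obstruction 3≤m 3∣n = pair-obstruction {3} 1 3≤m (s≤s (s≤s z≤n))
  (λ { (inj₁ ()) ; (inj₂ 2≡n) → 1+n≢0 (trans 2≡n 3∣n) })
  (λ { (inj₁ ()) ; (inj₂ 1≡n) → 1+n≢0 (trans 1≡n 3∣n) })

large-gap-obstruction : ∀ {D m} → 5 ≤ D → 3 ≤ m → ¬ Generates (D + m) (reversals (D + m) m)
large-gap-obstruction {D@(suc _)} {m} 5≤D 3≤m = choose-c ((D + m) % D ≟ 4 % D) ((D + m) % D ≟ 2 % D)
  where
  ≢-mod : ∀ k b → {0<k : True (0 <? k)} {k≤4 : True (k ≤? 4)} → (k + b) % D ≢ b % D
  ≢-mod k b {0<k} {k≤4} = %-shift-≢ b D (toWitness 0<k) (<-≤-trans (s≤s (toWitness k≤4)) 5≤D)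
  position : ∀ {c} → c ≤ 4 → c < D + m
  position c≤4 = <-≤-trans (s≤s c≤4) (≤-trans 5≤D (m≤m+n D m))
  -- c ∈ {1, 3, 4} works unless n ≡ c + 1 or c + 3 (mod D); as D ≥ 5, some c is left
  choose-c : Dec ((D + m) % D ≡ 4 % D) → Dec ((D + m) % D ≡ 2 % D) →
             ¬ Generates (D + m) (reversals (D + m) m)
  choose-c (yes n≡4) _ = pair-obstruction 4 3≤m (position ≤-refl)
    (λ { (inj₁ 0≡4) → ≢-mod 4 0 (sym 0≡4) ; (inj₂ 5≡n) → ≢-mod 1 4 (trans 5≡n n≡4) })
    (λ { (inj₁ 2≡4) → ≢-mod 2 2 (sym 2≡4) ; (inj₂ 7≡n) → ≢-mod 3 4 (trans 7≡n n≡4) })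
  choose-c (no n≢4) (yes n≡2) = pair-obstruction 3 3≤m (position (n≤1+n 3))
    (λ { (inj₁ 0≡3) → ≢-mod 3 0 (sym 0≡3) ; (inj₂ 4≡n) → n≢4 (sym 4≡n) })
    (λ { (inj₁ 2≡3) → ≢-mod 1 2 (sym 2≡3) ; (inj₂ 6≡n) → ≢-mod 4 2 (trans 6≡n n≡2) })
  choose-c (no n≢4) (no n≢2) = pair-obstruction 1 3≤m (position (s≤s z≤n))
    (λ { (inj₁ 0≡1) → ≢-mod 1 0 (sym 0≡1) ; (inj₂ 2≡n) → n≢2 (sym 2≡n) })
    (λ { (inj₁ 2≡1) → ≢-mod 1 1 2≡1 ; (inj₂ 4≡n) → n≢4 (sym 4≡n) })

residue-reflection : ∀ D .{{_ : NonZero D}} (χ : ℕ → Parity) p {i r} →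
                     (∀ {x} → x < D → ∀ {y} → y < D → (y + suc x) % D ≡ r → χ y ≡ p ℙ.+ χ x) →
                     i % D ≡ r → ∀ {u v} → v + suc u ≡ i → χ (v % D) ≡ p ℙ.+ χ (u % D)
residue-reflection D χ p {i} {r} on-residues i≡r {u} {v} v+1+u≡i =
  on-residues (m%n<n u D) (m%n<n v D) (begin
  (v % D + suc (u % D)) % D ≡⟨ %-+-cong {v % D} {v} {suc (u % D)} {suc u} D (m%n%n≡m%n v D)
                                  (%-+-cong {1} {1} {u % D} {u} D refl (m%n%n≡m%n u D)) ⟩
  (v + suc u) % D           ≡⟨ cong (_% D) v+1+u≡i ⟩
  i % D                     ≡⟨ i≡r ⟩
  r                         ∎)
  where open ≡-Reasoning

octet : ℕ → ℕ → Parity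
octet w x = if (x ≡ᵇ 0) ∨ (x ≡ᵇ 2) ∨ (x ≡ᵇ (w + 5) % 8) ∨ (x ≡ᵇ (w + 7) % 8) then 1ℙ else 0ℙ

octet-reflect-m : ∀ {w} → w < 8 → ∀ {x} → x < 8 → ∀ {y} → y < 8 →
                  (y + suc x) % 8 ≡ w → octet w y ≡ 0ℙ ℙ.+ octet w x
octet-reflect-m = from-yes (allUpTo? (λ w → allUpTo? (λ x → allUpTo? (λ y →
  (y + suc x) % 8 ≟ w →-dec octet w y ℙ.≟ 0ℙ ℙ.+ octet w x) 8) 8) 8)

octet-reflect-n : ∀ {w} → w < 8 → parity w ≡ 0ℙ → ∀ {x} → x < 8 → ∀ {y} → y < 8 →
                  (y + suc x) % 8 ≡ (4 + w) % 8 → octet w y ≡ 1ℙ ℙ.+ octet w x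
octet-reflect-n = from-yes (allUpTo? (λ w → parity w ℙ.≟ 0ℙ →-dec allUpTo? (λ x → allUpTo? (λ y →
  (y + suc x) % 8 ≟ (4 + w) % 8 →-dec octet w y ℙ.≟ 1ℙ ℙ.+ octet w x) 8) 8) 8)

octet-4 : ∀ {w} → w < 8 → parity w ≡ 0ℙ → octet w 4 ≡ 0ℙ
octet-4 = from-yes (allUpTo? (λ w → parity w ℙ.≟ 0ℙ →-dec octet w 4 ℙ.≟ 0ℙ) 8)

gap-4-obstruction : ∀ {m} → 1 ≤ m → parity m ≡ 0ℙ → ¬ Generates (4 + m) (reversals (4 + m) m)
gap-4-obstruction {m} 1≤m m-even = colouring-obstruction
  (reversals-compatible {m}
    (prefixRev-compatible 1ℙ ≤-refl (residue-reflection 8 (octet w) 1ℙ (octet-reflect-n w<8 w-even) n≡4+w)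
                          (⊥-elim ∘ <-irrefl refl))
    (prefixRev-compatible 0ℙ (m≤n+m m 4) (residue-reflection 8 (octet w) 0ℙ (octet-reflect-m w<8) refl)
                          (λ _ → refl))
    (prefixRev₃-compatible (s≤s (s≤s (s≤s z≤n))) refl))
  (s≤s z≤n) (+-monoʳ-≤ 4 1≤m) (s≤s (s≤s z≤n)) (λ ()) (λ ())
  (λ 1≡κ4 → 0ℙ≢1ℙ (trans (sym (octet-4 w<8 w-even)) (sym 1≡κ4)))
  where
  w : ℕ
  w = m % 8
  w<8 : w < 8
  w<8 = m%n<n m 8
  w-even : parity w ≡ 0ℙ
  w-even = trans (parity-%-even m 8 refl) m-even
  open Colouring {4 + m} (λ j → octet w (j % 8))
  n≡4+w : (4 + m) % 8 ≡ (4 + w) % 8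
  n≡4+w = %-distribˡ-+ 4 m 8

Condition : ℕ → ℕ → Set
Condition n m = (n % 2 ≡ 0 × m ≡ n ∸ 2)
              ⊎ (((n % 6 ≡ 1) ⊎ (n % 6 ≡ 5)) × ((m ≡ n ∸ 3) ⊎ (m ≡ n ∸ 1)))
              ⊎ (n % 6 ≡ 3 × m ≡ n ∸ 1)

parity-from-%6 : ∀ {n r} → n % 6 ≡ r → parity n ≡ parity r
parity-from-%6 {n} n≡r = trans (sym (parity-%-even n 6 refl)) (cong parity n≡r)

%3-from-%6 : ∀ {n r} → n % 6 ≡ r → n % 3 ≡ r % 3
%3-from-%6 {n} n≡r = trans (sym (m∣n⇒o%n%m≡o%m 3 6 n (divides 2 refl))) (cong (_% 3) n≡r)

even⇒%2≡0 : ∀ n → parity n ≡ 0ℙ → n % 2 ≡ 0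
even⇒%2≡0 n even with n % 2 | m%n<n n 2 | parity-%-even n 2 refl
... | 0 | _ | _ = refl
... | 1 | _ | odd = ⊥-elim (0ℙ≢1ℙ (trans (sym even) (sym odd)))
... | suc (suc _) | s≤s (s≤s ()) | _

odd-residues : ∀ n → parity n ≡ 1ℙ → n % 6 ≡ 1 ⊎ n % 6 ≡ 3 ⊎ n % 6 ≡ 5
odd-residues n odd = classify (n % 6) refl (m%n<n n 6) (trans (parity-%-even n 6 refl) odd)
  where
  classify : ∀ r → n % 6 ≡ r → r < 6 → parity r ≡ 1ℙ → n % 6 ≡ 1 ⊎ n % 6 ≡ 3 ⊎ n % 6 ≡ 5
  classify 1 n≡r _ _ = inj₁ n≡r
  classify 3 n≡r _ _ = inj₂ (inj₁ n≡r)
  classify 5 n≡r _ _ = inj₂ (inj₂ n≡r)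
  classify 0 _ _ ()
  classify 2 _ _ ()
  classify 4 _ _ ()
  classify (suc (suc (suc (suc (suc (suc _)))))) _ (s≤s (s≤s (s≤s (s≤s (s≤s (s≤s ())))))) _

coprime-to-6 : ∀ n → n % 6 ≡ 1 ⊎ n % 6 ≡ 5 → parity n ≡ 1ℙ × n % 3 ≢ 0
coprime-to-6 n (inj₁ n≡1) =
  parity-from-%6 {n} n≡1 , λ n≡0 → 1+n≢0 (trans (sym (%3-from-%6 {n} n≡1)) n≡0)
coprime-to-6 n (inj₂ n≡5) =
  parity-from-%6 {n} n≡5 , λ n≡0 → 1+n≢0 (trans (sym (%3-from-%6 {n} n≡5)) n≡0)

generates⇒m-even : ∀ {n m} → 3 ≤ m → m ≤ n → Generates n (reversals n m) → parity m ≡ 0ℙ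
generates⇒m-even {m = m} 3≤m m≤n generates with parity m in pm
... | 0ℙ = refl
... | 1ℙ = ⊥-elim (odd-m-obstruction 3≤m m≤n pm generates)

condition-necessary : ∀ d {m} → 3 < m → parity m ≡ 0ℙ → Generates (suc d + m) (reversals (suc d + m) m) →
                      Condition (suc d + m) m
condition-necessary 0 {m} _ m-even _ with odd-residues (1 + m) (even⇒odd-suc m m-even)
... | inj₁ n≡1 = inj₂ (inj₁ (inj₁ n≡1 , inj₂ refl))
... | inj₂ (inj₁ n≡3) = inj₂ (inj₂ (n≡3 , refl))
... | inj₂ (inj₂ n≡5) = inj₂ (inj₁ (inj₂ n≡5 , inj₂ refl))
condition-necessary 1 {m} _ m-even _ = inj₁ (even⇒%2≡0 (2 + m) m-even , refl)
condition-necessary 2 {m} 3<m m-even generates with odd-residues (3 + m) (even⇒odd-suc m m-even)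
... | inj₁ n≡1 = inj₂ (inj₁ (inj₁ n≡1 , inj₁ refl))
... | inj₂ (inj₁ n≡3) = ⊥-elim (gap-3-obstruction (<⇒≤ 3<m) (%3-from-%6 {3 + m} n≡3) generates)
... | inj₂ (inj₂ n≡5) = inj₂ (inj₁ (inj₂ n≡5 , inj₁ refl))
condition-necessary 3 3<m m-even generates =
  ⊥-elim (gap-4-obstruction (≤-trans (s≤s z≤n) 3<m) m-even generates)
condition-necessary (suc (suc (suc (suc e)))) 3<m _ generates =
  ⊥-elim (large-gap-obstruction (m≤m+n 5 e) (<⇒≤ 3<m) generates)

condition-sufficient : ∀ {n m} → 5 ≤ n → Condition n m → Generates n (reversals n m)
condition-sufficient {n} (s≤s (s≤s (s≤s (s≤s (s≤s {n = x} _))))) (inj₁ (n%2≡0 , refl)) =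
  generates-gap-2 (1 + x) (trans (sym (parity-%-even n 2 refl)) (cong parity n%2≡0))
condition-sufficient {n} (s≤s (s≤s (s≤s (s≤s (s≤s {n = x} _))))) (inj₂ (inj₁ (n≡1∨5 , inj₁ refl))) =
  generates-gap-3 x (odd-suc⇒even x (proj₁ (coprime-to-6 n n≡1∨5))) (proj₂ (coprime-to-6 n n≡1∨5))
condition-sufficient {n} (s≤s (s≤s (s≤s (s≤s (s≤s {n = x} _))))) (inj₂ (inj₁ (n≡1∨5 , inj₂ refl))) =
  generates-gap-1 (2 + x) (odd-suc⇒even x (proj₁ (coprime-to-6 n n≡1∨5)))
condition-sufficient {n} (s≤s (s≤s (s≤s (s≤s (s≤s {n = x} _))))) (inj₂ (inj₂ (n≡3 , refl))) =
  generates-gap-1 (2 + x) (odd-suc⇒even x (parity-from-%6 {n} n≡3))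

m<n⇒∃[d]1+d+m≡n : ∀ {m n} → m < n → ∃[ d ] suc d + m ≡ n
m<n⇒∃[d]1+d+m≡n {m} m<n with m≤n⇒∃[o]m+o≡n m<n
... | d , m+1+d≡n = d , trans (cong suc (+-comm d m)) m+1+d≡n

mainTheorem4 : (n m : ℕ) → 5 ≤ n → 3 < m → m < n →
    (Generates n (prefixRev n n ∷ prefixRev n m ∷ prefixRev n 3 ∷ [])
      ⇔ ((n % 2 ≡ 0 × m ≡ n ∸ 2)
         ⊎ (((n % 6 ≡ 1) ⊎ (n % 6 ≡ 5)) × ((m ≡ n ∸ 3) ⊎ (m ≡ n ∸ 1)))
         ⊎ (n % 6 ≡ 3 × m ≡ n ∸ 1)))
mainTheorem4 n m 5≤n 3<m m<n with m<n⇒∃[d]1+d+m≡n m<n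
... | d , refl = mk⇔
  (λ generates → condition-necessary d 3<m (generates⇒m-even (<⇒≤ 3<m) (<⇒≤ m<n) generates) generates)
  (condition-sufficient 5≤n)
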